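{- The following three subsets of $W_e$ coincide (this common set is denoted $W_e^+$): (1) $\{y^\lambda v:\lambda\in\mathbb Z_{\ge0}^n,\ v\in W_f\}$; (2) the submonoid of $W_e$ generated by $\pi$ and $W_f$; (3) $\{w\in W_e: w_i>0 \text{ for all } i\in[n]\}$.
   Context: Fix $n\ge2$. $W_e$: bijections $w:\mathbb Z\to\mathbb Z$ with $w(i+n)=w(i)+n$ and $\sum_{i=1}^n(w(i)-i)\equiv0\pmod n$; $s_i$ swaps $i+kn,i+1+kn$ for all $k$; $\pi:k\mapsto k+1$; $W_f=\langle s_1,\dots,s_{n-1}\rangle\cong\mathcal S_n$. Translations: $y_1=\pi s_{n-1}\cdots s_1$, $y_i=s_{i-1}\cdots s_1y_1s_1\cdots s_{i-1}$, $y^\lambda=\prod_iy_i^{\lambda_i}$. The word of $w$ is $w_i=n+1-w^{ -1}(i)$, $i\in\mathbb Z$. -}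

module Defs where

open import Data.Nat using (ℕ; zero; suc; _∸_; _≡ᵇ_) renaming (_≤_ to _≤ℕ_)
open import Data.Integer using (ℤ; +_; _+_; _-_; _>_)
open import Data.Integer.DivMod using (_%ℕ_)
open import Data.Integer.Divisibility using (_∣_)
open import Data.Bool using (if_then_else_)
open import Data.Fin using (Fin; toℕ)
open import Data.List using (List; foldr; map; allFin)
open import Data.List.Relation.Unary.All using (All)
open import Data.Product using (Σ; ∃; _×_)
open import Data.Sum using (_⊎_)
open import Function using (_∘_; id)
open import Relation.Binary.PropositionalEquality using (_≡_; _≗_)

-- residue of x modulo n (n ≥ 2 in all uses; the value for n = 0 is irrelevant)
res : ℕ → ℤ → ℕ
res zero    x = 0
res (suc k) x = x %ℕ suc k

sumTo : ℕ → (ℕ → ℤ) → ℤ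
sumTo zero    f = + 0
sumTo (suc k) f = sumTo k f + f (suc k)

record We (n : ℕ) : Set where
  field
    fun  : ℤ → ℤ
    inv  : ℤ → ℤ
    invˡ : ∀ x → inv (fun x) ≡ x
    invʳ : ∀ x → fun (inv x) ≡ x
    per  : ∀ x → fun (x + + n) ≡ fun x + + n
    sumc : (+ n) ∣ sumTo n (λ i → fun (+ i) - + i)
open We public

-- s_i : swaps i + kn and i+1 + kn for all k (1 ≤ i ≤ n-1)
s : (n i : ℕ) → ℤ → ℤ
s n i x =
  if res n (x - + i) ≡ᵇ 0 then x + + 1
  else if res n (x - + suc i) ≡ᵇ 0 then x - + 1
  else x

π : ℤ → ℤ
π x = x + + 1

compose : List (ℤ → ℤ) → ℤ → ℤ
compose = foldr (λ f g → f ∘ g) id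

sdesc : ℕ → ℕ → ℤ → ℤ
sdesc n zero    = id
sdesc n (suc k) = s n (suc k) ∘ sdesc n k

sasc : ℕ → ℕ → ℤ → ℤ
sasc n zero    = id
sasc n (suc k) = sasc n k ∘ s n (suc k)

y₁ : ℕ → ℤ → ℤ
y₁ n = π ∘ sdesc n (n ∸ 1)

y : ℕ → ℕ → ℤ → ℤ
y n i = sdesc n (i ∸ 1) ∘ y₁ n ∘ sasc n (i ∸ 1)

pow : (ℤ → ℤ) → ℕ → ℤ → ℤ
pow f zero    = id
pow f (suc k) = f ∘ pow f k

yPow : (n : ℕ) → (Fin n → ℕ) → ℤ → ℤ
yPow n λ' = compose (map (λ i → pow (y n (suc (toℕ i))) (λ' i)) (allFin n))

-- v ∈ W_f = ⟨s_1, …, s_{n-1}⟩ (a finite group generated by involutions,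
-- so the generated subgroup is the set of products of the generators)
InWf : (n : ℕ) → (ℤ → ℤ) → Set
InWf n v = Σ (List ℕ) λ is →
  All (λ i → (1 ≤ℕ i) × (i ≤ℕ n ∸ 1)) is × (v ≗ compose (map (s n) is))

InSet1 : (n : ℕ) → We n → Set
InSet1 n w = Σ (Fin n → ℕ) λ λ' → Σ (ℤ → ℤ) λ v →
  InWf n v × (fun w ≗ yPow n λ' ∘ v)

InSet2 : (n : ℕ) → We n → Set
InSet2 n w = Σ (List (ℤ → ℤ)) λ fs →
  All (λ f → (f ≗ π) ⊎ InWf n f) fs × (fun w ≗ compose fs)

word : (n : ℕ) → We n → ℤ → ℤ
word n w i = + suc n - inv w i

InSet3 : (n : ℕ) → We n → Set
InSet3 n w = ∀ (i : ℕ) → 1 ≤ℕ i → i ≤ℕ n → word n w (+ i) > + 0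

-- Write every integer as x = j + qN with 1 ≤ j ≤ N (block index j, level q). Then s_i
-- swaps the indices i and i+1 and keeps levels, π raises the index by one (from N to 1
-- at the next level), and y_t raises the level of index t by one and fixes every other
-- index, so y^λ v sends j + qN to σ j + (q + λ_{σ j})N whenever v ∈ W_f permutes the
-- indices by σ.
-- (1) ⊆ (2): each y_t is a product of π and the s_i.
-- (2) ⊆ (3): no generator moves an integer above N to one at most N, so w⁻¹(i) ≤ N for
-- i ∈ [N], which is w_i > 0.
-- (3) ⊆ (1): writing w(j) = σ j + b_j N, we have w⁻¹(σ j) = j - b_j N, so (3) says
-- exactly that every b_j ≥ 0; then w = y^λ v with λ_{σ j} = b_j and v the index
-- permutation σ, which lies in W_f by sorting with adjacent transpositions.

module Submission where

open import Defs
open import Data.Nat as ℕ using (ℕ; zero; suc; _≤_; _<_; z≤n; s≤s; pred)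
import Data.Nat.Properties as ℕP
open import Data.Integer as ℤ using (ℤ; +_; -[1+_]; _+_; _-_; _*_; -_; ∣_∣; 0ℤ)
import Data.Integer.Properties as ℤP
open import Data.Integer.DivMod using (_/ℕ_; n%ℕd<d; a≡a%ℕn+[a/ℕn]*n)
open import Data.Integer.Tactic.RingSolver using (solve-∀)
open import Data.Fin as Fin using (Fin; toℕ) renaming (zero to fzero; suc to fsuc)
import Data.Fin.Properties as FP
open import Data.List using (List; []; _∷_; map; _++_; reverse; downFrom; allFin)
import Data.List.Properties as LP
open import Data.List.Relation.Unary.All as All using (All; []; _∷_)
import Data.List.Relation.Unary.All.Properties as AllP
import Data.List.Relation.Unary.Any.Properties as AnyP
open import Data.Product using (Σ; _×_; _,_; proj₁; proj₂)
open import Data.Sum using (_⊎_; inj₁; inj₂)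
open import Data.Empty using (⊥-elim)
open import Function using (_∘_; id)
open import Relation.Binary.PropositionalEquality
open import Relation.Nullary using (¬_; Dec; yes; no)

+-cancelˡ : ∀ a {b c} → a + b ≡ a + c → b ≡ c
+-cancelˡ a {b} {c} eq = trans (undo a b) (trans (cong (_- a) eq) (sym (undo a c)))
  where
    undo : ∀ a x → x ≡ (a + x) - a
    undo = solve-∀

compose-++ : ∀ (fs gs : List (ℤ → ℤ)) x → compose (fs ++ gs) x ≡ compose fs (compose gs x)
compose-++ []       gs x = refl
compose-++ (f ∷ fs) gs x = cong f (compose-++ fs gs x)

weight : ∀ {m} → (Fin m → ℕ) → Fin m → List (Fin m) → ℕ
weight λ' f []       = 0
weight λ' f (i ∷ is) with i Fin.≟ f
... | yes _ = λ' i ℕ.+ weight λ' f is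
... | no _  = weight λ' f is

weight-zero-map-suc : ∀ {m} (λ' : Fin (suc m) → ℕ) is → weight λ' fzero (map fsuc is) ≡ 0
weight-zero-map-suc λ' []       = refl
weight-zero-map-suc λ' (i ∷ is) = weight-zero-map-suc λ' is

weight-suc-map-suc : ∀ {m} (λ' : Fin (suc m) → ℕ) f is → weight λ' (fsuc f) (map fsuc is) ≡ weight (λ' ∘ fsuc) f is
weight-suc-map-suc λ' f []       = refl
weight-suc-map-suc λ' f (i ∷ is) with fsuc i Fin.≟ fsuc f | i Fin.≟ f
... | yes _       | yes _   = cong (λ' (fsuc i) ℕ.+_) (weight-suc-map-suc λ' f is)
... | yes 1+i≡1+f | no i≢f  = ⊥-elim (i≢f (FP.suc-injective 1+i≡1+f))
... | no 1+i≢1+f  | yes i≡f = ⊥-elim (1+i≢1+f (cong fsuc i≡f))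
... | no _        | no _    = weight-suc-map-suc λ' f is

weight-allFin : ∀ {m} (λ' : Fin m → ℕ) f → weight λ' f (allFin m) ≡ λ' f
weight-allFin {suc m} λ' f = trans (cong (weight λ' f) (allFin-suc m)) (at f)
  where
    allFin-suc : ∀ m → allFin (suc m) ≡ fzero ∷ map fsuc (allFin m)
    allFin-suc m = cong (fzero ∷_) (sym (LP.map-tabulate id fsuc))
    at : ∀ f → weight λ' f (fzero ∷ map fsuc (allFin m)) ≡ λ' f
    at fzero    = trans (cong (λ' fzero ℕ.+_) (weight-zero-map-suc λ' (allFin m))) (ℕP.+-identityʳ (λ' fzero))
    at (fsuc f) = trans (weight-suc-map-suc λ' f (allFin m)) (weight-allFin (λ' ∘ fsuc) f)

All-reverse : ∀ {a p} {A : Set a} {P : A → Set p} {xs : List A} → All P xs → All P (reverse xs)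
All-reverse ps = All.tabulate (λ x∈ → All.lookup ps (AnyP.reverse⁻ x∈))

-- Adjacent transpositions of block indices

swap : ℕ → ℕ → ℕ
swap i j with j ℕ.≟ i
... | yes _ = suc i
... | no _ with j ℕ.≟ suc i
...   | yes _ = i
...   | no _  = j

swap-self : ∀ i → swap i i ≡ suc i
swap-self i with i ℕ.≟ i
... | yes _  = refl
... | no i≢i = ⊥-elim (i≢i refl)

swap-suc : ∀ i → swap i (suc i) ≡ i
swap-suc i with suc i ℕ.≟ i
... | yes 1+i≡i = ⊥-elim (ℕP.1+n≢n 1+i≡i)
... | no _ with suc i ℕ.≟ suc i
...   | yes _    = refl
...   | no 1+i≢1+i = ⊥-elim (1+i≢1+i refl)

swap-other : ∀ {i j} → j ≢ i → j ≢ suc i → swap i j ≡ j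
swap-other {i} {j} j≢i j≢1+i with j ℕ.≟ i
... | yes j≡i = ⊥-elim (j≢i j≡i)
... | no _ with j ℕ.≟ suc i
...   | yes j≡1+i = ⊥-elim (j≢1+i j≡1+i)
...   | no _      = refl

swap-involutive : ∀ i j → swap i (swap i j) ≡ j
swap-involutive i j = cases (j ℕ.≟ i) (j ℕ.≟ suc i)
  where
    cases : Dec (j ≡ i) → Dec (j ≡ suc i) → swap i (swap i j) ≡ j
    cases (yes j≡i) _ = subst (λ m → swap i (swap i m) ≡ m) (sym j≡i)
      (trans (cong (swap i) (swap-self i)) (swap-suc i))
    cases (no _) (yes j≡1+i) = subst (λ m → swap i (swap i m) ≡ m) (sym j≡1+i)
      (trans (cong (swap i) (swap-suc i)) (swap-self i))
    cases (no j≢i) (no j≢1+i) = trans (cong (swap i) (swap-other j≢i j≢1+i)) (swap-other j≢i j≢1+i)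

swap-bounded : ∀ {n i j} → 1 ≤ i → i < n → 1 ≤ j → j ≤ n → 1 ≤ swap i j × swap i j ≤ n
swap-bounded {n} {i} {j} 1≤i i<n 1≤j j≤n = cases (j ℕ.≟ i) (j ℕ.≟ suc i)
  where
    Bounded : ℕ → Set
    Bounded m = 1 ≤ m × m ≤ n
    cases : Dec (j ≡ i) → Dec (j ≡ suc i) → Bounded (swap i j)
    cases (yes j≡i) _ = subst (λ m → Bounded (swap i m)) (sym j≡i)
      (subst Bounded (sym (swap-self i)) (s≤s z≤n , i<n))
    cases (no _) (yes j≡1+i) = subst (λ m → Bounded (swap i m)) (sym j≡1+i)
      (subst Bounded (sym (swap-suc i)) (1≤i , ℕP.<⇒≤ i<n))
    cases (no j≢i) (no j≢1+i) = subst Bounded (sym (swap-other j≢i j≢1+i)) (1≤j , j≤n)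

swaps : List ℕ → ℕ → ℕ
swaps []       j = j
swaps (i ∷ is) j = swap i (swaps is j)

swaps-injective : ∀ is {j j′} → swaps is j ≡ swaps is j′ → j ≡ j′
swaps-injective []       eq = eq
swaps-injective (i ∷ is) {j} {j′} eq =
  swaps-injective is (trans (sym (swap-involutive i _)) (trans (cong (swap i) eq) (swap-involutive i _)))

climb : ℕ → ℕ → List ℕ
climb b d = map (b ℕ.+_) (downFrom d)

swaps-climb-bottom : ∀ b d → swaps (climb b d) b ≡ b ℕ.+ d
swaps-climb-bottom b zero    = sym (ℕP.+-identityʳ b)
swaps-climb-bottom b (suc d) = begin
    swap (b ℕ.+ d) (swaps (climb b d) b)   ≡⟨ cong (swap (b ℕ.+ d)) (swaps-climb-bottom b d) ⟩
    swap (b ℕ.+ d) (b ℕ.+ d)               ≡⟨ swap-self (b ℕ.+ d) ⟩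
    suc (b ℕ.+ d)                          ≡⟨ ℕP.+-suc b d ⟨
    b ℕ.+ suc d                            ∎
  where open ≡-Reasoning

swaps-climb-above : ∀ b d {j} → b ℕ.+ d < j → swaps (climb b d) j ≡ j
swaps-climb-above b zero    _ = refl
swaps-climb-above b (suc d) {j} b+1+d<j =
  trans (cong (swap (b ℕ.+ d)) (swaps-climb-above b d (ℕP.<-trans (ℕP.n<1+n _) 1+b+d<j)))
        (swap-other (ℕP.>⇒≢ (ℕP.<-trans (ℕP.n<1+n _) 1+b+d<j)) (ℕP.>⇒≢ 1+b+d<j))
  where
    1+b+d<j : suc (b ℕ.+ d) < j
    1+b+d<j = subst (_< j) (ℕP.+-suc b d) b+1+d<j

swaps-climb-within : ∀ b d {j} → b < j → j ≤ b ℕ.+ d → swaps (climb b d) j ≡ pred j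
swaps-climb-within b zero    {j} b<j j≤b+0 = ⊥-elim (ℕP.<⇒≱ b<j (subst (j ≤_) (ℕP.+-identityʳ b) j≤b+0))
swaps-climb-within b (suc d) {suc j} b<1+j 1+j≤b+1+d with suc j ℕ.≤? b ℕ.+ d
... | yes 1+j≤b+d = trans (cong (swap (b ℕ.+ d)) (swaps-climb-within b d b<1+j 1+j≤b+d))
                          (swap-other (ℕP.<⇒≢ 1+j≤b+d) (ℕP.<⇒≢ (ℕP.<-trans 1+j≤b+d (ℕP.n<1+n _))))
... | no 1+j≰b+d = begin
    swap (b ℕ.+ d) (swaps (climb b d) (suc j))   ≡⟨ cong (swap (b ℕ.+ d)) (swaps-climb-above b d (ℕP.≰⇒> 1+j≰b+d)) ⟩
    swap (b ℕ.+ d) (suc j)                       ≡⟨ cong (swap (b ℕ.+ d)) 1+j≡1+b+d ⟩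
    swap (b ℕ.+ d) (suc (b ℕ.+ d))               ≡⟨ swap-suc (b ℕ.+ d) ⟩
    b ℕ.+ d                                      ≡⟨ ℕP.suc-injective 1+j≡1+b+d ⟨
    j                                            ∎
  where
    open ≡-Reasoning
    1+j≡1+b+d : suc j ≡ suc (b ℕ.+ d)
    1+j≡1+b+d = ℕP.≤-antisym (subst (suc j ≤_) (ℕP.+-suc b d) 1+j≤b+1+d) (ℕP.≰⇒> 1+j≰b+d)

-- Block coordinates

module Blocks (k : ℕ) where

  N : ℕ
  N = suc k

  block : ℕ → ℤ → ℤ
  block j q = + j + q * + N

  multiple-below-N : ∀ t → t ℕ.* N < N → t ≡ 0
  multiple-below-N zero    _  = refl
  multiple-below-N (suc t) tN<N = ⊥-elim (ℕP.<-irrefl refl (ℕP.<-≤-trans tN<N (ℕP.m≤m+n N (t ℕ.* N))))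

  congruent-below-N : ∀ {a b} t → a < N → b < N → + a ≡ + b + t * + N → a ≡ b
  congruent-below-N {a} {b} t a<N b<N eq =
    ℤP.+-injective (trans eq (trans (cong (λ u → + b + u * + N) t≡0) (ℤP.+-identityʳ (+ b))))
    where
      tN≡a-b : t * + N ≡ + a - + b
      tN≡a-b = trans (move (+ b) (t * + N)) (cong (_- + b) (sym eq))
        where
          move : ∀ x y → y ≡ (x + y) - x
          move = solve-∀
      t≡0 : t ≡ 0ℤ
      t≡0 = ℤP.∣i∣≡0⇒i≡0 (multiple-below-N ∣ t ∣ (begin-strict
        ∣ t ∣ ℕ.* N         ≡⟨ ℤP.abs-* t (+ N) ⟨
        ∣ t * + N ∣         ≡⟨ cong ∣_∣ (trans tN≡a-b (ℤP.m-n≡m⊖n a b)) ⟩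
        ∣ a ℤ.⊖ b ∣         ≤⟨ ℤP.∣m⊝n∣≤m⊔n a b ⟩
        a ℕ.⊔ b             <⟨ ℕP.⊔-lub a<N b<N ⟩
        N                   ∎))
        where open ℕP.≤-Reasoning

  divMod-unique : ∀ {r r′ q q′} → r < N → r′ < N →
                  + r + q * + N ≡ + r′ + q′ * + N → r ≡ r′ × q ≡ q′
  divMod-unique {r} {r′} {q} {q′} r<N r′<N eq = r≡r′ , q≡q′
    where
      r≡r′ : r ≡ r′
      r≡r′ = congruent-below-N (q′ - q) r<N r′<N
        (trans (shift (+ r) q (+ N)) (trans (cong (_- q * + N) eq) (shift′ (+ r′) q′ q (+ N))))
        where
          shift : ∀ x q n → x ≡ (x + q * n) - q * n
          shift = solve-∀
          shift′ : ∀ x q′ q n → (x + q′ * n) - q * n ≡ x + (q′ - q) * n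
          shift′ = solve-∀
      q≡q′ : q ≡ q′
      q≡q′ = ℤP.*-cancelʳ-≡ q q′ (+ N) (+-cancelˡ (+ r) (trans eq (cong (λ u → + u + q′ * + N) (sym r≡r′))))

  res-block : ∀ {r} q → r < N → res N (+ r + q * + N) ≡ r
  res-block {r} q r<N = sym (proj₁ (divMod-unique {q = q} {q′ = x /ℕ N} r<N (n%ℕd<d x N) (a≡a%ℕn+[a/ℕn]*n x N)))
    where x = + r + q * + N

  record BlockView (x : ℤ) : Set where
    constructor view
    field
      index   : ℕ
      level   : ℤ
      1≤index : 1 ≤ index
      index≤N : index ≤ N
      x≡block : x ≡ block index level

  blockView : ∀ x → BlockView x
  blockView x = view (suc (res N x-1)) (x-1 /ℕ N) (s≤s z≤n) (n%ℕd<d x-1 N) (begin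
      x                                            ≡⟨ pred-suc x ⟩
      + 1 + x-1                                    ≡⟨ cong (_+_ (+ 1)) (a≡a%ℕn+[a/ℕn]*n x-1 N) ⟩
      + 1 + (+ res N x-1 + (x-1 /ℕ N) * + N)       ≡⟨ ℤP.+-assoc (+ 1) (+ res N x-1) ((x-1 /ℕ N) * + N) ⟨
      + suc (res N x-1) + (x-1 /ℕ N) * + N         ∎)
    where
      open ≡-Reasoning
      x-1 = x - + 1
      pred-suc : ∀ x → x ≡ + 1 + (x - + 1)
      pred-suc = solve-∀

  block-injective : ∀ {j j′ q q′} → 1 ≤ j → j ≤ N → 1 ≤ j′ → j′ ≤ N →
                    block j q ≡ block j′ q′ → j ≡ j′ × q ≡ q′
  block-injective {suc a} {suc b} {q} {q′} _ a<N _ b<N eq with divMod-unique a<N b<N eq′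
    where
      eq′ : + a + q * + N ≡ + b + q′ * + N
      eq′ = +-cancelˡ (+ 1) (trans (sym (ℤP.+-assoc (+ 1) (+ a) (q * + N))) (trans eq (ℤP.+-assoc (+ 1) (+ b) (q′ * + N))))
  ... | a≡b , q≡q′ = cong suc a≡b , q≡q′

  index-block : ∀ {j q} → 1 ≤ j → j ≤ N → BlockView.index (blockView (block j q)) ≡ j
  index-block {j} {q} 1≤j j≤N = let open BlockView (blockView (block j q)) in
    proj₁ (block-injective {q = level} {q′ = q} 1≤index index≤N 1≤j j≤N (sym x≡block))

  level-block : ∀ {j q} → 1 ≤ j → j ≤ N → BlockView.level (blockView (block j q)) ≡ q
  level-block {j} {q} 1≤j j≤N = let open BlockView (blockView (block j q)) in
    proj₂ (block-injective {q = level} {q′ = q} 1≤index index≤N 1≤j j≤N (sym x≡block))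

  res[block-j]≡0 : ∀ j q → res N (block j q - + j) ≡ 0
  res[block-j]≡0 j q = trans (cong (res N) (drop (+ j) q (+ N))) (res-block q (s≤s z≤n))
    where
      drop : ∀ a q n → (a + q * n) - a ≡ + 0 + q * n
      drop = solve-∀

  res[block-i]≡0⇒j≡i : ∀ {j i} q → 1 ≤ j → j ≤ N → 1 ≤ i → i ≤ N → res N (block j q - + i) ≡ 0 → j ≡ i
  res[block-i]≡0⇒j≡i {suc a} {suc b} q _ a<N _ b<N r≡0 = cong suc (congruent-below-N (t - q) a<N b<N eq)
    where
      d = block (suc a) q - + suc b
      t = d /ℕ N
      d≡tN : d ≡ + 0 + t * + N
      d≡tN = trans (a≡a%ℕn+[a/ℕn]*n d N) (cong (λ r → + r + t * + N) r≡0)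
      unshift : ∀ a b q n → a ≡ ((+ 1 + a + q * n) - (+ 1 + b)) + b - q * n
      unshift = solve-∀
      regroup : ∀ b q t n → (+ 0 + t * n) + b - q * n ≡ b + (t - q) * n
      regroup = solve-∀
      eq : + a ≡ + b + (t - q) * + N
      eq = trans (unshift (+ a) (+ b) q (+ N)) (trans (cong (λ u → u + + b - q * + N) d≡tN) (regroup (+ b) q t (+ N)))

  N<block : ∀ {j q} → 1 ≤ j → 0ℤ ℤ.< q → + N ℤ.< block j q
  N<block {j} {q} 1≤j 0<q = begin-strict
      + N             <⟨ ℤ.+<+ (ℕP.n<1+n N) ⟩
      + 1 + + N       ≤⟨ ℤP.+-mono-≤ (ℤ.+≤+ 1≤j) N≤qN ⟩
      + j + q * + N   ∎
    where
      open ℤP.≤-Reasoning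
      N≤qN : + N ℤ.≤ q * + N
      N≤qN = subst (ℤ._≤ q * + N) (ℤP.*-identityˡ (+ N)) (ℤP.*-monoʳ-≤-nonNeg (+ N) (ℤP.i<j⇒suc[i]≤j 0<q))

  block≤N⇒level≤0 : ∀ {j q} → 1 ≤ j → block j q ℤ.≤ + N → q ℤ.≤ 0ℤ
  block≤N⇒level≤0 1≤j b≤N = ℤP.≮⇒≥ (λ 0<q → ℤP.<⇒≱ (N<block 1≤j 0<q) b≤N)

  level≤0⇒block≤N : ∀ {j q} → j ≤ N → q ℤ.≤ 0ℤ → block j q ℤ.≤ + N
  level≤0⇒block≤N {j} {q} j≤N q≤0 = begin
      + j + q * + N    ≤⟨ ℤP.+-monoʳ-≤ (+ j) (ℤP.*-monoʳ-≤-nonNeg (+ N) q≤0) ⟩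
      + j + 0ℤ * + N   ≡⟨ ℤP.+-identityʳ (+ j) ⟩
      + j              ≤⟨ ℤ.+≤+ j≤N ⟩
      + N              ∎
    where open ℤP.≤-Reasoning

  Periodic : (ℤ → ℤ) → Set
  Periodic f = ∀ x → f (x + + N) ≡ f x + + N

  periodic-+ℕ : ∀ f → Periodic f → ∀ x a → f (x + + a * + N) ≡ f x + + a * + N
  periodic-+ℕ f p x zero    = trans (cong f (ℤP.+-identityʳ x)) (sym (ℤP.+-identityʳ (f x)))
  periodic-+ℕ f p x (suc a) = begin
      f (x + + suc a * + N)       ≡⟨ cong f (split x (+ a) (+ N)) ⟩
      f ((x + + a * + N) + + N)   ≡⟨ p _ ⟩
      f (x + + a * + N) + + N     ≡⟨ cong (_+ + N) (periodic-+ℕ f p x a) ⟩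
      (f x + + a * + N) + + N     ≡⟨ split (f x) (+ a) (+ N) ⟨
      f x + + suc a * + N         ∎
    where
      open ≡-Reasoning
      split : ∀ x a n → x + (+ 1 + a) * n ≡ (x + a * n) + n
      split = solve-∀

  periodic-shift : ∀ f → Periodic f → ∀ x q → f (x + q * + N) ≡ f x + q * + N
  periodic-shift f p x (+ a)    = periodic-+ℕ f p x a
  periodic-shift f p x -[1+ m ] = begin
      f x′                                      ≡⟨ there-and-back (f x′) (+ suc m) (+ N) ⟩
      (f x′ + + suc m * + N) + -[1+ m ] * + N   ≡⟨ cong (_+ -[1+ m ] * + N) (periodic-+ℕ f p x′ (suc m)) ⟨
      f (x′ + + suc m * + N) + -[1+ m ] * + N   ≡⟨ cong (λ z → f z + -[1+ m ] * + N) (back-and-there x (+ suc m) (+ N)) ⟩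
      f x + -[1+ m ] * + N                      ∎
    where
      open ≡-Reasoning
      x′ = x + -[1+ m ] * + N
      there-and-back : ∀ a b n → a ≡ (a + b * n) + (- b) * n
      there-and-back = solve-∀
      back-and-there : ∀ a b n → (a + (- b) * n) + b * n ≡ a
      back-and-there = solve-∀

  inv-periodic : (w : We N) → Periodic (inv w)
  inv-periodic w x = begin
      inv w (x + + N)                   ≡⟨ cong (λ z → inv w (z + + N)) (invʳ w x) ⟨
      inv w (fun w (inv w x) + + N)     ≡⟨ cong (inv w) (per w (inv w x)) ⟨
      inv w (fun w (inv w x + + N))     ≡⟨ invˡ w _ ⟩
      inv w x + + N                     ∎
    where open ≡-Reasoning

-- The generators in block coordinates

module Generators (k : ℕ) where
  open Blocks k

  s-block : ∀ {i j} q → 1 ≤ i → i < N → 1 ≤ j → j ≤ N → s N i (block j q) ≡ block (swap i j) q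
  s-block {i} {j} q 1≤i i<N 1≤j j≤N with j ℕ.≟ i
  ... | yes refl rewrite res[block-j]≡0 j q = up (+ j) q (+ N)
    where
      up : ∀ a q n → a + q * n + + 1 ≡ + 1 + a + q * n
      up = solve-∀
  ... | no j≢i with res N (block j q - + i) in rᵢ
  ...   | zero  = ⊥-elim (j≢i (res[block-i]≡0⇒j≡i q 1≤j j≤N 1≤i (ℕP.<⇒≤ i<N) rᵢ))
  ...   | suc _ with j ℕ.≟ suc i
  ...     | yes refl rewrite res[block-j]≡0 j q = down (+ i) q (+ N)
    where
      down : ∀ a q n → + 1 + a + q * n - + 1 ≡ a + q * n
      down = solve-∀
  ...     | no j≢1+i with res N (block j q - + suc i) in rᵢ₊₁
  ...       | zero  = ⊥-elim (j≢1+i (res[block-i]≡0⇒j≡i q 1≤j j≤N (s≤s z≤n) i<N rᵢ₊₁))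
  ...       | suc _ = refl

  s-involutive : ∀ {i} → 1 ≤ i → i < N → ∀ x → s N i (s N i x) ≡ x
  s-involutive {i} 1≤i i<N x with blockView x
  ... | view j q 1≤j j≤N refl = let 1≤j′ , j′≤N = swap-bounded 1≤i i<N 1≤j j≤N in begin
      s N i (s N i (block j q))        ≡⟨ cong (s N i) (s-block q 1≤i i<N 1≤j j≤N) ⟩
      s N i (block (swap i j) q)       ≡⟨ s-block q 1≤i i<N 1≤j′ j′≤N ⟩
      block (swap i (swap i j)) q      ≡⟨ cong (λ m → block m q) (swap-involutive i j) ⟩
      block j q                        ∎
    where open ≡-Reasoning

  π-block : ∀ j q → π (block j q) ≡ block (suc j) q
  π-block j q = up (+ j) q (+ N)
    where
      up : ∀ a q n → a + q * n + + 1 ≡ + 1 + a + q * n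
      up = solve-∀

  π-block-N : ∀ q → π (block N q) ≡ block 1 (q + + 1)
  π-block-N q = wrap q (+ N)
    where
      wrap : ∀ q n → n + q * n + + 1 ≡ + 1 + (q + + 1) * n
      wrap = solve-∀

  Generator : ℕ → Set
  Generator i = 1 ≤ i × i ≤ N ℕ.∸ 1

  sprod : List ℕ → ℤ → ℤ
  sprod is = compose (map (s N) is)

  swaps-bounded : ∀ {is j} → All Generator is → 1 ≤ j → j ≤ N → 1 ≤ swaps is j × swaps is j ≤ N
  swaps-bounded []                 1≤j j≤N = 1≤j , j≤N
  swaps-bounded ((1≤i , i≤k) ∷ gs) 1≤j j≤N =
    let 1≤j′ , j′≤N = swaps-bounded gs 1≤j j≤N in swap-bounded 1≤i (s≤s i≤k) 1≤j′ j′≤N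

  sprod-block : ∀ {is j} q → All Generator is → 1 ≤ j → j ≤ N → sprod is (block j q) ≡ block (swaps is j) q
  sprod-block q []                 1≤j j≤N = refl
  sprod-block {i ∷ is} q ((1≤i , i≤k) ∷ gs) 1≤j j≤N =
    let 1≤j′ , j′≤N = swaps-bounded gs 1≤j j≤N in
    trans (cong (s N i) (sprod-block q gs 1≤j j≤N)) (s-block q 1≤i (s≤s i≤k) 1≤j′ j′≤N)

  sprod-++ : ∀ is js x → sprod (is ++ js) x ≡ sprod is (sprod js x)
  sprod-++ is js x = trans (cong (λ fs → compose fs x) (LP.map-++ (s N) is js)) (compose-++ (map (s N) is) (map (s N) js) x)

  sprod-reverse-cancel : ∀ {is} → All Generator is → ∀ x → sprod (reverse is) (sprod is x) ≡ x
  sprod-reverse-cancel []                          x = refl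
  sprod-reverse-cancel {i ∷ is} ((1≤i , i≤k) ∷ gs) x = begin
      sprod (reverse (i ∷ is)) (sprod (i ∷ is) x)       ≡⟨ cong (λ js → sprod js (sprod (i ∷ is) x)) (LP.unfold-reverse i is) ⟩
      sprod (reverse is ++ i ∷ []) (sprod (i ∷ is) x)   ≡⟨ sprod-++ (reverse is) (i ∷ []) _ ⟩
      sprod (reverse is) (s N i (s N i (sprod is x)))   ≡⟨ cong (sprod (reverse is)) (s-involutive 1≤i (s≤s i≤k) _) ⟩
      sprod (reverse is) (sprod is x)                   ≡⟨ sprod-reverse-cancel gs x ⟩
      x                                                 ∎
    where open ≡-Reasoning

  climb-generators : ∀ b d → 1 ≤ b → b ℕ.+ d ≤ N → All Generator (climb b d)
  climb-generators b zero    _   _       = []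
  climb-generators b (suc d) 1≤b b+1+d≤N =
    (ℕP.≤-trans 1≤b (ℕP.m≤m+n b d) , ℕP.≤-pred (subst (_≤ N) (ℕP.+-suc b d) b+1+d≤N))
    ∷ climb-generators b d 1≤b (ℕP.≤-trans (ℕP.+-monoʳ-≤ b (ℕP.n≤1+n d)) b+1+d≤N)

  sdesc-sprod : ∀ t x → sdesc N t x ≡ sprod (climb 1 t) x
  sdesc-sprod zero    x = refl
  sdesc-sprod (suc t) x = cong (s N (suc t)) (sdesc-sprod t x)

  sdesc-block : ∀ {c} q → 1 ≤ c → c ≤ N → sdesc N k (block c q) ≡ block (swaps (climb 1 k) c) q
  sdesc-block q 1≤c c≤N = trans (sdesc-sprod k _) (sprod-block q (climb-generators 1 k (s≤s z≤n) ℕP.≤-refl) 1≤c c≤N)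

  y₁-block-1 : ∀ q → y₁ N (block 1 q) ≡ block 1 (q + + 1)
  y₁-block-1 q = begin
      π (sdesc N k (block 1 q))              ≡⟨ cong π (sdesc-block q ℕP.≤-refl (s≤s z≤n)) ⟩
      π (block (swaps (climb 1 k) 1) q)      ≡⟨ cong (λ m → π (block m q)) (swaps-climb-bottom 1 k) ⟩
      π (block N q)                          ≡⟨ π-block-N q ⟩
      block 1 (q + + 1)                      ∎
    where open ≡-Reasoning

  y₁-block-other : ∀ {c} q → 1 < c → c ≤ N → y₁ N (block c q) ≡ block c q
  y₁-block-other {suc c} q 1<c c≤N = begin
      π (sdesc N k (block (suc c) q))         ≡⟨ cong π (sdesc-block q (s≤s z≤n) c≤N) ⟩
      π (block (swaps (climb 1 k) (suc c)) q) ≡⟨ cong (λ m → π (block m q)) (swaps-climb-within 1 k 1<c c≤N) ⟩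
      π (block c q)                           ≡⟨ π-block c q ⟩
      block (suc c) q                         ∎
    where open ≡-Reasoning

  -- y N (2+t) unfolds definitionally to s_{1+t} ∘ y N (1+t) ∘ s_{1+t}.
  y-block-own : ∀ t q → t < N → y N (suc t) (block (suc t) q) ≡ block (suc t) (q + + 1)
  y-block-own zero    q _     = y₁-block-1 q
  y-block-own (suc t) q 2+t≤N = begin
      s N (suc t) (y N (suc t) (s N (suc t) (block (suc (suc t)) q)))
        ≡⟨ cong (s N (suc t) ∘ y N (suc t)) (s-block q (s≤s z≤n) 2+t≤N (s≤s z≤n) 2+t≤N) ⟩
      s N (suc t) (y N (suc t) (block (swap (suc t) (suc (suc t))) q))
        ≡⟨ cong (λ m → s N (suc t) (y N (suc t) (block m q))) (swap-suc (suc t)) ⟩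
      s N (suc t) (y N (suc t) (block (suc t) q))
        ≡⟨ cong (s N (suc t)) (y-block-own t q (ℕP.<-trans (ℕP.n<1+n t) 2+t≤N)) ⟩
      s N (suc t) (block (suc t) (q + + 1))
        ≡⟨ s-block (q + + 1) (s≤s z≤n) 2+t≤N (s≤s z≤n) (ℕP.<⇒≤ 2+t≤N) ⟩
      block (swap (suc t) (suc t)) (q + + 1)
        ≡⟨ cong (λ m → block m (q + + 1)) (swap-self (suc t)) ⟩
      block (suc (suc t)) (q + + 1)
        ∎
    where open ≡-Reasoning

  y-block-other : ∀ t {c} q → t < N → 1 ≤ c → c ≤ N → c ≢ suc t → y N (suc t) (block c q) ≡ block c q
  y-block-other zero    q _ 1≤c c≤N c≢1 = y₁-block-other q (ℕP.≤∧≢⇒< 1≤c (c≢1 ∘ sym)) c≤N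
  y-block-other (suc t) {c} q 2+t≤N 1≤c c≤N c≢2+t = begin
      s N (suc t) (y N (suc t) (s N (suc t) (block c q)))
        ≡⟨ cong (s N (suc t) ∘ y N (suc t)) (s-block q (s≤s z≤n) 2+t≤N 1≤c c≤N) ⟩
      s N (suc t) (y N (suc t) (block c′ q))
        ≡⟨ cong (s N (suc t)) (y-block-other t q (ℕP.<-trans (ℕP.n<1+n t) 2+t≤N) 1≤c′ c′≤N c′≢1+t) ⟩
      s N (suc t) (block c′ q)
        ≡⟨ s-block q (s≤s z≤n) 2+t≤N 1≤c′ c′≤N ⟩
      block (swap (suc t) c′) q
        ≡⟨ cong (λ m → block m q) (swap-involutive (suc t) c) ⟩
      block c q
        ∎
    where
      open ≡-Reasoning
      c′ = swap (suc t) c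
      1≤c′ = proj₁ (swap-bounded (s≤s z≤n) 2+t≤N 1≤c c≤N)
      c′≤N = proj₂ (swap-bounded (s≤s z≤n) 2+t≤N 1≤c c≤N)
      c′≢1+t : c′ ≢ suc t
      c′≢1+t c′≡1+t = c≢2+t (trans (sym (swap-involutive (suc t) c)) (trans (cong (swap (suc t)) c′≡1+t) (swap-self (suc t))))

  pow-y-own : ∀ t g q → t < N → pow (y N (suc t)) g (block (suc t) q) ≡ block (suc t) (q + + g)
  pow-y-own t zero    q _   = cong (block (suc t)) (sym (ℤP.+-identityʳ q))
  pow-y-own t (suc g) q t<N = begin
      y N (suc t) (pow (y N (suc t)) g (block (suc t) q))   ≡⟨ cong (y N (suc t)) (pow-y-own t g q t<N) ⟩
      y N (suc t) (block (suc t) (q + + g))                 ≡⟨ y-block-own t (q + + g) t<N ⟩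
      block (suc t) (q + + g + + 1)                         ≡⟨ cong (block (suc t)) (+-suc q (+ g)) ⟩
      block (suc t) (q + + suc g)                           ∎
    where
      open ≡-Reasoning
      +-suc : ∀ q g → q + g + + 1 ≡ q + (+ 1 + g)
      +-suc = solve-∀

  pow-y-other : ∀ t {c} g q → t < N → 1 ≤ c → c ≤ N → c ≢ suc t → pow (y N (suc t)) g (block c q) ≡ block c q
  pow-y-other t zero    q _   _   _   _     = refl
  pow-y-other t (suc g) q t<N 1≤c c≤N c≢1+t =
    trans (cong (y N (suc t)) (pow-y-other t g q t<N 1≤c c≤N c≢1+t)) (y-block-other t q t<N 1≤c c≤N c≢1+t)

  pows : (Fin N → ℕ) → List (Fin N) → ℤ → ℤ
  pows λ' is = compose (map (λ i → pow (y N (suc (toℕ i))) (λ' i)) is)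

  pows-block : ∀ λ' is f q → pows λ' is (block (suc (toℕ f)) q) ≡ block (suc (toℕ f)) (q + + weight λ' f is)
  pows-block λ' []       f q = cong (block _) (sym (ℤP.+-identityʳ q))
  pows-block λ' (i ∷ is) f q with i Fin.≟ f
  ... | yes refl = begin
      pow (y N (suc (toℕ i))) (λ' i) (pows λ' is (block (suc (toℕ i)) q))
        ≡⟨ cong (pow (y N (suc (toℕ i))) (λ' i)) (pows-block λ' is i q) ⟩
      pow (y N (suc (toℕ i))) (λ' i) (block (suc (toℕ i)) (q + + w))
        ≡⟨ pow-y-own (toℕ i) (λ' i) (q + + w) (FP.toℕ<n i) ⟩
      block (suc (toℕ i)) (q + + w + + λ' i)
        ≡⟨ cong (block (suc (toℕ i))) (trans (swap-summands q (+ w) (+ λ' i)) (cong (_+_ q) (sym (ℤP.pos-+ (λ' i) w)))) ⟩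
      block (suc (toℕ i)) (q + + (λ' i ℕ.+ w))
        ∎
    where
      open ≡-Reasoning
      w = weight λ' i is
      swap-summands : ∀ q a b → q + a + b ≡ q + (b + a)
      swap-summands = solve-∀
  ... | no i≢f = trans (cong (pow (y N (suc (toℕ i))) (λ' i)) (pows-block λ' is f q))
                       (pow-y-other (toℕ i) (λ' i) (q + + weight λ' f is) (FP.toℕ<n i) (s≤s z≤n) (FP.toℕ<n f) 1+f≢1+i)
    where
      1+f≢1+i : suc (toℕ f) ≢ suc (toℕ i)
      1+f≢1+i e = i≢f (FP.toℕ-injective (ℕP.suc-injective (sym e)))

  yPow-block : ∀ λ' f q → yPow N λ' (block (suc (toℕ f)) q) ≡ block (suc (toℕ f)) (q + + λ' f)
  yPow-block λ' f q = trans (pows-block λ' (allFin N) f q) (cong (λ m → block (suc (toℕ f)) (q + + m)) (weight-allFin λ' f))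

  record BlockPermutation (v : ℤ → ℤ) : Set where
    field
      σ           : ℕ → ℕ
      σ-bounded   : ∀ {j} → 1 ≤ j → j ≤ N → 1 ≤ σ j × σ j ≤ N
      σ-injective : ∀ {j j′} → 1 ≤ j → j ≤ N → 1 ≤ j′ → j′ ≤ N → σ j ≡ σ j′ → j ≡ j′
      v-block     : ∀ {j} q → 1 ≤ j → j ≤ N → v (block j q) ≡ block (σ j) q

  open BlockPermutation

  sprod-∘-permutation : ∀ {L v} → All Generator L → (P : BlockPermutation v) → BlockPermutation (sprod L ∘ v)
  sprod-∘-permutation {L} gens P = record
    { σ           = swaps L ∘ σ P
    ; σ-bounded   = λ 1≤j j≤N → let 1≤σj , σj≤N = σ-bounded P 1≤j j≤N in swaps-bounded gens 1≤σj σj≤N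
    ; σ-injective = λ 1≤j j≤N 1≤j′ j′≤N e → σ-injective P 1≤j j≤N 1≤j′ j′≤N (swaps-injective L e)
    ; v-block     = λ q 1≤j j≤N → let 1≤σj , σj≤N = σ-bounded P 1≤j j≤N in
                      trans (cong (sprod L) (v-block P q 1≤j j≤N)) (sprod-block q gens 1≤σj σj≤N)
    }

  InWf-cancel-sprod : ∀ {L v} → All Generator L → InWf N (sprod L ∘ v) → InWf N v
  InWf-cancel-sprod {L} {v} gens (is , is-gens , Lv≗) = reverse L ++ is , AllP.++⁺ (All-reverse gens) is-gens , v≗
    where
      v≗ : ∀ x → v x ≡ sprod (reverse L ++ is) x
      v≗ x = begin
        v x                                ≡⟨ sprod-reverse-cancel gens (v x) ⟨
        sprod (reverse L) (sprod L (v x))  ≡⟨ cong (sprod (reverse L)) (Lv≗ x) ⟩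
        sprod (reverse L) (sprod is x)     ≡⟨ sprod-++ (reverse L) is x ⟨
        sprod (reverse L ++ is) x          ∎
        where open ≡-Reasoning

  -- Selection sort: s_m ⋯ s_b carries the entry b = σ (1+m) ≤ 1+m to position 1+m.
  permutation-fixing-above-∈Wf : ∀ m → m ≤ N → ∀ {v} (P : BlockPermutation v) →
                                 (∀ {j} → m < j → j ≤ N → σ P j ≡ j) → InWf N v
  permutation-fixing-above-∈Wf zero _ {v} P fixed = [] , [] , λ x → v-id x (blockView x)
    where
      v-id : ∀ x → BlockView x → v x ≡ x
      v-id _ (view j q 1≤j j≤N refl) = trans (v-block P q 1≤j j≤N) (cong (λ m → block m q) (fixed 1≤j j≤N))
  permutation-fixing-above-∈Wf (suc m) 1+m≤N P fixed =
    InWf-cancel-sprod L-gens (permutation-fixing-above-∈Wf m (ℕP.<⇒≤ 1+m≤N) (sprod-∘-permutation L-gens P) fixed′)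
    where
      b = σ P (suc m)
      1≤b = proj₁ (σ-bounded P (s≤s z≤n) 1+m≤N)
      b≤N = proj₂ (σ-bounded P (s≤s z≤n) 1+m≤N)
      b≤1+m : b ≤ suc m
      b≤1+m = ℕP.≮⇒≥ λ 1+m<b →
        ℕP.<⇒≢ 1+m<b (sym (σ-injective P 1≤b b≤N (s≤s z≤n) 1+m≤N (fixed 1+m<b b≤N)))
      d = suc m ℕ.∸ b
      b+d≡1+m : b ℕ.+ d ≡ suc m
      b+d≡1+m = ℕP.m+[n∸m]≡n b≤1+m
      L = climb b d
      L-gens : All Generator L
      L-gens = climb-generators b d 1≤b (subst (_≤ N) (sym b+d≡1+m) 1+m≤N)
      fixed′ : ∀ {j} → m < j → j ≤ N → swaps L (σ P j) ≡ j
      fixed′ {j} m<j j≤N with j ℕ.≟ suc m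
      ... | yes refl = trans (swaps-climb-bottom b d) b+d≡1+m
      ... | no j≢1+m = trans (cong (swaps L) (fixed 1+m<j j≤N)) (swaps-climb-above b d (subst (_< j) (sym b+d≡1+m) 1+m<j))
        where 1+m<j = ℕP.≤∧≢⇒< m<j (j≢1+m ∘ sym)

  permutation-∈Wf : ∀ {v} → BlockPermutation v → InWf N v
  permutation-∈Wf P = permutation-fixing-above-∈Wf N ℕP.≤-refl P (λ N<j j≤N → ⊥-elim (ℕP.<⇒≱ N<j j≤N))

  yPow-block-ℕ : ∀ (lam : ℕ → ℕ) {c} q → 1 ≤ c → c ≤ N → yPow N (lam ∘ suc ∘ toℕ) (block c q) ≡ block c (q + + lam c)
  yPow-block-ℕ lam {suc c} q _ c<N = subst (λ m → yPow N (lam ∘ suc ∘ toℕ) (block (suc m) q) ≡ block (suc m) (q + + lam (suc m)))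
    (FP.toℕ-fromℕ< c<N) (yPow-block (lam ∘ suc ∘ toℕ) (Fin.fromℕ< c<N) q)

-- The three descriptions of W_e^+

module Theorem (k : ℕ) where
  open Blocks k
  open Generators k

  InMonoid : (ℤ → ℤ) → Set
  InMonoid f = Σ (List (ℤ → ℤ)) λ fs → All (λ g → (g ≗ π) ⊎ InWf N g) fs × (f ≗ compose fs)

  InMonoid-generator : ∀ {f} → (f ≗ π) ⊎ InWf N f → InMonoid f
  InMonoid-generator {f} g = f ∷ [] , g ∷ [] , λ _ → refl

  InMonoid-id : InMonoid id
  InMonoid-id = [] , [] , λ _ → refl

  InMonoid-∘ : ∀ {f g} → InMonoid f → InMonoid g → InMonoid (f ∘ g)
  InMonoid-∘ {f} {g} (fs , f-gens , f≗) (gs , g-gens , g≗) =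
    fs ++ gs , AllP.++⁺ f-gens g-gens ,
    λ x → trans (f≗ (g x)) (trans (cong (compose fs) (g≗ x)) (sym (compose-++ fs gs x)))

  InMonoid-pow : ∀ {f} → InMonoid f → ∀ g → InMonoid (pow f g)
  InMonoid-pow f∈ zero    = InMonoid-id
  InMonoid-pow f∈ (suc g) = InMonoid-∘ f∈ (InMonoid-pow f∈ g)

  InMonoid-s : ∀ {i} → 1 ≤ i → i < N → InMonoid (s N i)
  InMonoid-s {i} 1≤i (s≤s i≤k) = InMonoid-generator (inj₂ (i ∷ [] , (1≤i , i≤k) ∷ [] , λ _ → refl))

  InMonoid-y : ∀ t → t < N → InMonoid (y N (suc t))
  InMonoid-y zero    _     = InMonoid-∘ (InMonoid-generator (inj₁ λ _ → refl))
    (InMonoid-generator (inj₂ (climb 1 k , climb-generators 1 k (s≤s z≤n) ℕP.≤-refl , sdesc-sprod k)))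
  InMonoid-y (suc t) 2+t≤N = InMonoid-∘ s∈ (InMonoid-∘ (InMonoid-y t (ℕP.<-trans (ℕP.n<1+n t) 2+t≤N)) s∈)
    where s∈ = InMonoid-s (s≤s z≤n) 2+t≤N

  InMonoid-pows : ∀ λ' is → InMonoid (pows λ' is)
  InMonoid-pows λ' []       = InMonoid-id
  InMonoid-pows λ' (i ∷ is) = InMonoid-∘ (InMonoid-pow (InMonoid-y (toℕ i) (FP.toℕ<n i)) (λ' i)) (InMonoid-pows λ' is)

  one→two : ∀ w → InSet1 N w → InSet2 N w
  one→two w (λ' , v , v∈Wf , w≗) =
    let fs , gens , ≗fs = InMonoid-∘ (InMonoid-pows λ' (allFin N)) (InMonoid-generator (inj₂ v∈Wf)) in
    fs , gens , λ x → trans (w≗ x) (≗fs x)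

  AboveN : ℤ → Set
  AboveN x = ¬ (x ℤ.≤ + N)

  generator-AboveN : ∀ {g x} → (g ≗ π) ⊎ InWf N g → AboveN x → AboveN (g x)
  generator-AboveN {g} {x} (inj₁ g≗π) x>N gx≤N =
    x>N (ℤP.≤-trans (ℤP.i≤i+j x (+ 1)) (subst (ℤ._≤ + N) (g≗π x) gx≤N))
  generator-AboveN {g} {x} (inj₂ (is , gens , g≗)) x>N with blockView x
  ... | view j q 1≤j j≤N refl = λ gx≤N →
    let 1≤j′ , _ = swaps-bounded gens 1≤j j≤N
        gx≡ = trans (g≗ _) (sprod-block q gens 1≤j j≤N)
    in x>N (level≤0⇒block≤N {q = q} j≤N (block≤N⇒level≤0 {q = q} 1≤j′ (subst (ℤ._≤ + N) gx≡ gx≤N)))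

  InMonoid-AboveN : ∀ {f} → InMonoid f → ∀ {x} → AboveN x → AboveN (f x)
  InMonoid-AboveN (fs , gens , f≗) {x} x>N = subst AboveN (sym (f≗ x)) (compose-AboveN gens)
    where
      compose-AboveN : ∀ {fs} → All (λ g → (g ≗ π) ⊎ InWf N g) fs → AboveN (compose fs x)
      compose-AboveN []           = x>N
      compose-AboveN (g ∷ gens′) = generator-AboveN g (compose-AboveN gens′)

  x≤N⇒0<[1+N]-x : ∀ x → x ℤ.≤ + N → 0ℤ ℤ.< + suc N - x
  x≤N⇒0<[1+N]-x x x≤N = subst (0ℤ ℤ.<_) (sym (unfold (+ N) x)) (ℤP.suc[i]≤j⇒i<j (ℤP.suc-mono (ℤP.i≤j⇒0≤j-i x≤N)))
    where
      unfold : ∀ n x → (+ 1 + n) - x ≡ + 1 + (n - x)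
      unfold = solve-∀

  0<[1+N]-x⇒x≤N : ∀ x → 0ℤ ℤ.< + suc N - x → x ℤ.≤ + N
  0<[1+N]-x⇒x≤N x 0<d = ℤP.0≤i-j⇒j≤i (subst (0ℤ ℤ.≤_) (sym (unfold (+ N) x)) (ℤP.i≤j⇒0≤j-i (ℤP.i<j⇒suc[i]≤j 0<d)))
    where
      unfold : ∀ n x → n - x ≡ ((+ 1 + n) - x) - + 1
      unfold = solve-∀

  two→three : ∀ w → InSet2 N w → InSet3 N w
  two→three w w∈ i 1≤i i≤N = x≤N⇒0<[1+N]-x (inv w (+ i)) (ℤP.≮⇒≥ λ N<inv →
    InMonoid-AboveN w∈ (ℤP.<⇒≱ N<inv) (subst (ℤ._≤ + N) (sym (invʳ w (+ i))) (ℤ.+≤+ i≤N)))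

  module FromPositiveWord (w : We N) (positive : InSet3 N w) where
    open BlockView

    σ : ℕ → ℕ
    σ j = index (blockView (fun w (+ j)))

    b : ℕ → ℤ
    b j = level (blockView (fun w (+ j)))

    w-at : ∀ j → fun w (+ j) ≡ block (σ j) (b j)
    w-at j = x≡block (blockView (fun w (+ j)))

    σ-bounded : ∀ {j} → 1 ≤ j → j ≤ N → 1 ≤ σ j × σ j ≤ N
    σ-bounded {j} _ _ = 1≤index (blockView (fun w (+ j))) , index≤N (blockView (fun w (+ j)))

    inv-at-σ : ∀ j → inv w (+ σ j) ≡ block j (- b j)
    inv-at-σ j = begin
        inv w (+ σ j)                                  ≡⟨ cong (inv w) (back (+ σ j) (b j) (+ N)) ⟩
        inv w (block (σ j) (b j) + (- b j) * + N)      ≡⟨ periodic-shift (inv w) (inv-periodic w) _ (- b j) ⟩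
        inv w (block (σ j) (b j)) + (- b j) * + N      ≡⟨ cong (λ z → inv w z + (- b j) * + N) (w-at j) ⟨
        inv w (fun w (+ j)) + (- b j) * + N            ≡⟨ cong (_+ (- b j) * + N) (invˡ w (+ j)) ⟩
        block j (- b j)                                ∎
      where
        open ≡-Reasoning
        back : ∀ c q n → c ≡ (c + q * n) + (- q) * n
        back = solve-∀

    σ-injective : ∀ {j j′} → 1 ≤ j → j ≤ N → 1 ≤ j′ → j′ ≤ N → σ j ≡ σ j′ → j ≡ j′
    σ-injective {j} {j′} 1≤j j≤N 1≤j′ j′≤N σj≡σj′ = proj₁ (block-injective {q = - b j} {q′ = - b j′} 1≤j j≤N 1≤j′ j′≤N
      (trans (sym (inv-at-σ j)) (trans (cong (λ c → inv w (+ c)) σj≡σj′) (inv-at-σ j′))))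

    -- The exponent λ_c is read off w⁻¹(c) = block (σ⁻¹ c) (- λ_c).
    λℤ : ℕ → ℤ
    λℤ c = - level (blockView (inv w (+ c)))

    λℤ-σ : ∀ {j} → 1 ≤ j → j ≤ N → λℤ (σ j) ≡ b j
    λℤ-σ {j} 1≤j j≤N = trans (cong (λ x → - level (blockView x)) (inv-at-σ j))
                             (trans (cong -_ (level-block 1≤j j≤N)) (ℤP.neg-involutive (b j)))

    b-nonnegative : ∀ {j} → 1 ≤ j → j ≤ N → 0ℤ ℤ.≤ b j
    b-nonnegative {j} 1≤j j≤N = ℤP.neg-cancel-≤ (block≤N⇒level≤0 1≤j (subst (ℤ._≤ + N) (inv-at-σ j)
      (0<[1+N]-x⇒x≤N _ (positive (σ j) (proj₁ (σ-bounded 1≤j j≤N)) (proj₂ (σ-bounded 1≤j j≤N))))))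

    lam : ℕ → ℕ
    lam c = ∣ λℤ c ∣

    lam-σ : ∀ {j} → 1 ≤ j → j ≤ N → + lam (σ j) ≡ b j
    lam-σ 1≤j j≤N = trans (cong (+_ ∘ ∣_∣) (λℤ-σ 1≤j j≤N)) (ℤP.0≤i⇒+∣i∣≡i (b-nonnegative 1≤j j≤N))

    v : ℤ → ℤ
    v x = block (σ (index (blockView x))) (level (blockView x))

    v-block : ∀ {j} q → 1 ≤ j → j ≤ N → v (block j q) ≡ block (σ j) q
    v-block {j} q 1≤j j≤N = cong₂ (λ c q′ → block (σ c) q′) (index-block {j} {q} 1≤j j≤N) (level-block {j} {q} 1≤j j≤N)

    v-permutation : BlockPermutation v
    v-permutation = record { σ = σ ; σ-bounded = σ-bounded ; σ-injective = σ-injective ; v-block = v-block }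

    w≗yPow∘v : ∀ x → fun w x ≡ yPow N (lam ∘ suc ∘ toℕ) (v x)
    w≗yPow∘v x with blockView x
    ... | view j q 1≤j j≤N refl = begin
        fun w (block j q)                          ≡⟨ periodic-shift (fun w) (per w) (+ j) q ⟩
        fun w (+ j) + q * + N                      ≡⟨ cong (_+ q * + N) (w-at j) ⟩
        block (σ j) (b j) + q * + N                ≡⟨ regroup (+ σ j) (b j) q (+ N) ⟩
        block (σ j) (q + b j)                      ≡⟨ cong (λ z → block (σ j) (q + z)) (lam-σ 1≤j j≤N) ⟨
        block (σ j) (q + + lam (σ j))              ≡⟨ yPow-block-ℕ lam q 1≤σj σj≤N ⟨
        yPow N (lam ∘ suc ∘ toℕ) (block (σ j) q)   ≡⟨ cong (yPow N (lam ∘ suc ∘ toℕ)) (v-block q 1≤j j≤N) ⟨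
        yPow N (lam ∘ suc ∘ toℕ) (v (block j q))   ∎
      where
        open ≡-Reasoning
        1≤σj = proj₁ (σ-bounded 1≤j j≤N)
        σj≤N = proj₂ (σ-bounded 1≤j j≤N)
        regroup : ∀ c b q n → (c + b * n) + q * n ≡ c + (q + b) * n
        regroup = solve-∀

  three→one : ∀ w → InSet3 N w → InSet1 N w
  three→one w positive = lam ∘ suc ∘ toℕ , v , permutation-∈Wf v-permutation , w≗yPow∘v
    where open FromPositiveWord w positive

mainTheorem7 : (n : ℕ) → 2 ≤ n → (w : We n) →
    ((InSet1 n w → InSet2 n w) × (InSet2 n w → InSet1 n w)) ×
    ((InSet2 n w → InSet3 n w) × (InSet3 n w → InSet2 n w))
mainTheorem7 (suc k) _ w =
  (one→two w , three→one w ∘ two→three w) , (two→three w , one→two w ∘ three→one w)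
  where open Theorem k
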